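{- Let $p$ be a prime. For each integer $\alpha>0$, the group-annihilator graph $\Gamma(\mathbb{Z}/p^{\alpha}\mathbb{Z})$ is a connected threshold graph.
   Context: For a finite abelian group $G$ viewed as a $\mathbb{Z}$-module and $x\in G$, $[x:G]=\{r\in\mathbb{Z} : rG\subseteq\mathbb{Z}x\}$. The group-annihilator graph $\Gamma(G)$ has vertex set $G$, with distinct $x,y$ adjacent iff $[x:G][y:G]G=\{0\}$ (product of ideals of $\mathbb{Z}$). A threshold graph is a graph obtained from a single vertex by repeatedly (in any order, any number of times) adding either an isolated vertex or a dominating vertex (a new vertex adjacent to all existing vertices). -}

module Defs where

open import Data.Nat as ℕ using (ℕ; zero; suc)
open import Data.Integer as ℤ using (ℤ; +_; _-_; _*_; _+_)
open import Data.Integer.Divisibility using (_∣_)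
open import Data.Fin using (Fin; zero; suc; toℕ)
open import Data.List using (List; map; foldr)
open import Data.List.Relation.Unary.All using (All)
open import Data.Product using (Σ; ∃; _×_; _,_; proj₁; proj₂)
open import Data.Unit using (⊤)
open import Data.Empty using (⊥)
open import Relation.Nullary using (¬_)
open import Relation.Binary.PropositionalEquality using (_≡_)
open import Relation.Binary.Construct.Closure.ReflexiveTransitive using (Star)
open import Function.Bundles using (_↔_; Inverse)

-- The cyclic group ℤ/nℤ, with carrier Fin n (element i represents the
-- residue class of toℕ i), viewed as a ℤ-module.

rep : {n : ℕ} → Fin n → ℤ
rep i = + toℕ i

_≡[_]_ : ℤ → ℕ → ℤ → Set
a ≡[ n ] b = (+ n) ∣ (a - b)

colon : (n : ℕ) → Fin n → ℤ → Set
colon n x r = (g : Fin n) → ∃ λ (k : ℤ) → (r * rep g) ≡[ n ] (k * rep x)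

IdealProd : (ℤ → Set) → (ℤ → Set) → ℤ → Set
IdealProd I J s =
  ∃ λ (ps : List (ℤ × ℤ)) →
    All (λ ab → I (proj₁ ab) × J (proj₂ ab)) ps ×
    s ≡ foldr _+_ (+ 0) (map (λ ab → proj₁ ab * proj₂ ab) ps)

AnnCond : (n : ℕ) → Fin n → Fin n → Set
AnnCond n x y =
  (s : ℤ) (g : Fin n) → IdealProd (colon n x) (colon n y) s →
    (s * rep g) ≡[ n ] (+ 0)

GAAdj : (n : ℕ) → Fin n → Fin n → Set
GAAdj n x y = ¬ (x ≡ y) × AnnCond n x y

Connected : {V : Set} → (V → V → Set) → Set
Connected {V} E = (x y : V) → Star E x y

-- Construction sequences of threshold graphs: start from one vertex and
-- repeatedly add an isolated or a dominating vertex.  The newly added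
-- vertex is numbered zero; old vertices are shifted by suc.
data Build : ℕ → Set where
  start  : Build 1
  addIso : {n : ℕ} → Build n → Build (suc n)
  addDom : {n : ℕ} → Build n → Build (suc n)

BAdj : {n : ℕ} → Build n → Fin n → Fin n → Set
BAdj start      _       _       = ⊥
BAdj (addIso b) zero    _       = ⊥
BAdj (addIso b) (suc i) zero    = ⊥
BAdj (addIso b) (suc i) (suc j) = BAdj b i j
BAdj (addDom b) zero    zero    = ⊥
BAdj (addDom b) zero    (suc j) = ⊤
BAdj (addDom b) (suc i) zero    = ⊤
BAdj (addDom b) (suc i) (suc j) = BAdj b i j

IsThreshold : {V : Set} → (V → V → Set) → Set
IsThreshold {V} E =
  ∃ λ (n : ℕ) → ∃ λ (b : Build n) → ∃ λ (f : Fin n ↔ V) →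
    (i j : Fin n) →
      (BAdj b i j → E (Inverse.to f i) (Inverse.to f j)) ×
      (E (Inverse.to f i) (Inverse.to f j) → BAdj b i j)

{-# OPTIONS --safe #-}

-- In ℤ/nℤ the ideal [x:G] is generated by gcd(x,n): it contains gcd(x,n) by
-- Bézout, and testing r ∈ [x:G] on the generator 1 shows gcd(x,n) ∣ r.  Hence
-- x and y are adjacent iff x ≢ y and n ∣ gcd(x,n)·gcd(y,n).  For n = p^α write
-- gcd(x,n) = p^w(x); then distinct x, y are adjacent iff α ≤ w(x) + w(y).
-- Any graph of this "weight sum above a threshold" shape is a threshold graph:
-- a vertex v of least weight either has no neighbour, or it has a neighbour x,
-- and then x is adjacent to every other vertex; remove that vertex and recurse.
-- Finally 0 has gcd(0,n) = n, so it is adjacent to all other vertices.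

module Submission where

open import Defs
open import Data.Nat as ℕ using (ℕ; zero; suc; _^_; _>_; _≤_; _<_; _≤?_; s≤s; z≤n)
import Data.Nat.Properties as ℕₚ
open import Data.Nat.Divisibility as ℕᵈ using (divides; _∣?_) renaming (_∣_ to _∣ℕ_)
open import Data.Nat.GCD using (gcd; gcd-GCD; module Bézout; gcd[m,n]∣m; gcd[m,n]∣n)
open import Data.Nat.Coprimality using (Coprime; coprime-divisor)
open import Data.Nat.Primality using (Prime; prime⇒irreducible; prime⇒nonZero; prime⇒nonTrivial)
open import Data.Integer as ℤ using (ℤ; +_; -_; _+_; _*_; _-_)
import Data.Integer.Properties as ℤₚ
open import Data.Integer.Divisibility.Signed
  using (_∣_; divides; ∣-refl; ∣ᵤ⇒∣; ∣⇒∣ᵤ; ∣-trans; ∣m∣n⇒∣m+n; ∣m+n∣n⇒∣m; ∣m⇒∣-m;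
         ∣n⇒∣m*n; ∣m⇒∣m*n; *-monoˡ-∣; *-monoʳ-∣)
open import Data.Integer.Tactic.RingSolver using (solve-∀)
open import Data.Fin using (Fin; zero; suc; toℕ; punchIn; _≟_)
open import Data.Fin.Properties using (any?; punchIn-injective; punchInᵢ≢i)
open import Data.Fin.Permutation using (insert; insert-punchIn)
open import Data.List using ([]; _∷_; allFin; map; foldr)
open import Data.List.Relation.Unary.All as All using (All; []; _∷_)
open import Data.List.Membership.Propositional.Properties using (∈-allFin)
open import Data.List.Extrema.Nat using (argmin; f[argmin]≤f[xs])
open import Data.Product using (∃; ∃₂; _×_; _,_; proj₁; proj₂)
open import Data.Product.Function.NonDependent.Propositional using (_×-⇔_)
open import Data.Sum using (inj₁; inj₂)
open import Data.Unit using (tt)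
open import Function using (_∘_)
open import Function.Bundles using (_↔_; Inverse; _⇔_; mk⇔; Equivalence)
open import Function.Construct.Composition using (_⇔-∘_)
open import Function.Construct.Identity using (↔-id; ⇔-id)
open import Function.Definitions using (Injective)
open import Relation.Binary.Definitions using (DecidableEquality)
open import Relation.Binary.Construct.Closure.ReflexiveTransitive using (Star; ε; _◅_; _◅◅_)
open import Relation.Binary.PropositionalEquality
open import Relation.Nullary using (¬_; yes; no)
open import Relation.Nullary.Decidable using (_×-dec_; ¬?)
open import Relation.Nullary.Negation using (contradiction)

open Equivalence using (to; from)

Realises : {V : Set} {n : ℕ} → Build n → Fin n ↔ V → (V → V → Set) → Set
Realises b f E =
  ∀ i j → (BAdj b i j → E (Inverse.to f i) (Inverse.to f j)) ×
          (E (Inverse.to f i) (Inverse.to f j) → BAdj b i j)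

Isolated : {V : Set} → (V → V → Set) → V → Set
Isolated E x = ∀ y → ¬ E x y × ¬ E y x

Dominating : {V : Set} → (V → V → Set) → V → Set
Dominating E x = ∀ y → y ≢ x → E x y × E y x

dominating⇒connected : {V : Set} {E : V → V → Set} → DecidableEquality V →
                       ∀ {c} → Dominating E c → Connected E
dominating⇒connected {E = E} _≟ᵥ_ {c} dom x y = toCentre x ◅◅ fromCentre y
  where
  toCentre : ∀ x → Star E x c
  toCentre x with x ≟ᵥ c
  ... | yes refl = ε
  ... | no x≢c   = proj₂ (dom x x≢c) ◅ ε
  fromCentre : ∀ y → Star E c y
  fromCentre y with y ≟ᵥ c
  ... | yes refl = ε
  ... | no y≢c   = proj₁ (dom y y≢c) ◅ ε

module _ {N : ℕ} {E : Fin (suc (suc N)) → Fin (suc (suc N)) → Set}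
         (irrefl : ∀ {x} → ¬ E x x) (x : Fin (suc (suc N)))
         {b : Build (suc N)} {f : Fin (suc N) ↔ Fin (suc N)}
         (realises : Realises b f (λ i j → E (punchIn x i) (punchIn x j))) where

  private
    to-suc : ∀ k → Inverse.to (insert zero x f) (suc k) ≡ punchIn x (Inverse.to f k)
    to-suc = insert-punchIn zero x f

  addDom-realises : Dominating E x → Realises (addDom b) (insert zero x f) E
  addDom-realises dom zero    zero    = (λ ()) , irrefl
  addDom-realises dom zero    (suc j) rewrite to-suc j =
    (λ _ → proj₁ (dom _ (punchInᵢ≢i x _))) , λ _ → tt
  addDom-realises dom (suc i) zero    rewrite to-suc i =
    (λ _ → proj₂ (dom _ (punchInᵢ≢i x _))) , λ _ → tt
  addDom-realises dom (suc i) (suc j) rewrite to-suc i | to-suc j = realises i j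

  addIso-realises : Isolated E x → Realises (addIso b) (insert zero x f) E
  addIso-realises iso zero    zero    = (λ ()) , irrefl
  addIso-realises iso zero    (suc j) rewrite to-suc j = (λ ()) , proj₁ (iso _)
  addIso-realises iso (suc i) zero    rewrite to-suc i = (λ ()) , proj₂ (iso _)
  addIso-realises iso (suc i) (suc j) rewrite to-suc i | to-suc j = realises i j

WeightAdj : {V : Set} → (V → ℕ) → ℕ → V → V → Set
WeightAdj w t x y = x ≢ y × t ≤ w x ℕ.+ w y

weightAdj-sym : {V : Set} {w : V → ℕ} {t : ℕ} {x y : V} → WeightAdj w t x y → WeightAdj w t y x
weightAdj-sym {w = w} {t} {x} {y} (x≢y , t≤) =
  ≢-sym x≢y , subst (t ≤_) (ℕₚ.+-comm (w x) (w y)) t≤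

module _ {V : Set} {E : V → V → Set} (w : V → ℕ) (t : ℕ)
         (E⇔ : ∀ x y → E x y ⇔ WeightAdj w t x y) where

  weightAdj-irrefl : ∀ {x} → ¬ E x x
  weightAdj-irrefl {x} e = proj₁ (to (E⇔ x x) e) refl

  weightAdj-on : {A : Set} (g : A → V) → Injective _≡_ _≡_ g →
                 ∀ i j → E (g i) (g j) ⇔ WeightAdj (w ∘ g) t i j
  weightAdj-on g g-inj i j = (mk⇔ (_∘ cong g) (_∘ g-inj)  ×-⇔ ⇔-id _) ⇔-∘ E⇔ (g i) (g j)

  -- x reaches the threshold with v, and every other vertex is at least as heavy as v.
  neighbour-of-lightest-dominates : ∀ {v x} → (∀ y → w v ≤ w y) → WeightAdj w t v x →
                                    Dominating E x
  neighbour-of-lightest-dominates {v} {x} lightest (_ , t≤vx) y y≢x =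
    from (E⇔ x y) x~y , from (E⇔ y x) (weightAdj-sym {w = w} x~y)
    where
    x~y : WeightAdj w t x y
    x~y = ≢-sym y≢x , ℕₚ.≤-trans t≤vx (subst (_≤ w x ℕ.+ w y) (ℕₚ.+-comm (w x) (w v))
                                         (ℕₚ.+-monoʳ-≤ (w x) (lightest y)))

  lonely⇒isolated : ∀ {v} → ¬ ∃ (WeightAdj w t v) → Isolated E v
  lonely⇒isolated lonely y = (λ e → lonely (y , to (E⇔ _ y) e))
                           , (λ e → lonely (y , weightAdj-sym {w = w} (to (E⇔ y _) e)))

lightest : ∀ {N} (w : Fin (suc N) → ℕ) → ∃ λ v → ∀ y → w v ≤ w y
lightest w = argmin w zero (allFin _) ,
  λ y → All.lookup (f[argmin]≤f[xs] {f = w} zero (allFin _)) (∈-allFin y)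

weightAdj-realisable : ∀ {N} {E : Fin (suc N) → Fin (suc N) → Set}
                       (w : Fin (suc N) → ℕ) (t : ℕ) →
                       (∀ x y → E x y ⇔ WeightAdj w t x y) →
                       ∃₂ λ (b : Build (suc N)) f → Realises b f E
weightAdj-realisable {zero} w t E⇔ =
  start , ↔-id _ , λ { zero zero → (λ ()) , weightAdj-irrefl w t E⇔ }
-- lightest w is handed to a helper instead of being matched with `with`:
-- abstracting it makes Agda normalise argmin and run out of memory.
weightAdj-realisable {suc N} {E} w t E⇔ = extend (lightest w)
  where
  irrefl : ∀ {x} → ¬ E x x
  irrefl = weightAdj-irrefl w t E⇔
  realise-without : ∀ x → ∃₂ λ (b : Build (suc N)) f →
                      Realises b f (λ i j → E (punchIn x i) (punchIn x j))
  realise-without x = weightAdj-realisable (w ∘ punchIn x) t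
               (weightAdj-on w t E⇔ (punchIn x) (punchIn-injective x _ _))
  extend : (∃ λ v → ∀ y → w v ≤ w y) → ∃₂ λ (b : Build (suc (suc N))) f → Realises b f E
  extend (v , v-lightest) with any? (λ x → ¬? (v ≟ x) ×-dec (t ≤? w v ℕ.+ w x))
  ... | yes (x , v~x) = let b , f , r = realise-without x in
    addDom b , insert zero x f ,
    addDom-realises {E = E} irrefl x {b} {f} r (neighbour-of-lightest-dominates w t E⇔ v-lightest v~x)
  ... | no lonely = let b , f , r = realise-without v in
    addIso b , insert zero v f ,
    addIso-realises {E = E} irrefl v {b} {f} r (lonely⇒isolated w t E⇔ lonely)

private
  pos-linear : ∀ d k m l a → d ℕ.+ k ℕ.* m ≡ l ℕ.* a → + d + + k * + m ≡ + l * + a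
  pos-linear d k m l a eq = begin
    + d + + k * + m    ≡⟨ cong (_+_ (+ d)) (ℤₚ.pos-* k m) ⟨
    + d + + (k ℕ.* m)  ≡⟨ ℤₚ.pos-+ d (k ℕ.* m) ⟨
    + (d ℕ.+ k ℕ.* m)  ≡⟨ cong +_ eq ⟩
    + (l ℕ.* a)        ≡⟨ ℤₚ.pos-* l a ⟩
    + l * + a          ∎
    where open ≡-Reasoning

  unshiftʳ : ∀ d k m → d ≡ (d + k * m) + - k * m
  unshiftʳ = solve-∀

  unshiftˡ : ∀ d k m → d ≡ - k * m + (d + k * m)
  unshiftˡ = solve-∀

bézout : ∀ a n → ∃₂ λ c e → + gcd a n ≡ c * + a + e * + n
bézout a n with Bézout.identity (gcd-GCD a n)
... | Bézout.+- x y eq =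
  + x , - + y ,
  trans (unshiftʳ (+ gcd a n) (+ y) (+ n)) (cong (_+ - + y * + n) (pos-linear _ y n x a eq))
... | Bézout.-+ x y eq =
  - + x , + y ,
  trans (unshiftˡ (+ gcd a n) (+ x) (+ a)) (cong (_+_ (- + x * + a)) (pos-linear _ x a y n eq))

gcd∣⇒colon : ∀ {n} (x : Fin n) → ∀ {r} → + gcd (toℕ x) n ∣ r → colon n x r
gcd∣⇒colon {n} x (divides m refl) g with bézout (toℕ x) n
... | c , e , gcd≡ = m * rep g * c , ∣⇒∣ᵤ (divides (m * rep g * e) (begin
  m * + gcd (toℕ x) n * rep g - m * rep g * c * rep x
    ≡⟨ cong (λ d → m * d * rep g - m * rep g * c * rep x) gcd≡ ⟩
  m * (c * rep x + e * + n) * rep g - m * rep g * c * rep x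
    ≡⟨ expand m (rep g) c (rep x) e (+ n) ⟩
  m * rep g * e * + n ∎))
  where
  open ≡-Reasoning
  expand : ∀ m h c a e n → m * (c * a + e * n) * h - m * h * c * a ≡ m * h * e * n
  expand = solve-∀

colon⇒gcd∣ : ∀ {n} → 1 < n → (x : Fin n) → ∀ {r} → colon n x r → + gcd (toℕ x) n ∣ r
colon⇒gcd∣ {n} (s≤s (s≤s z≤n)) x {r} r∈colon with r∈colon (suc zero)
... | k , n∣r-kx = ∣m+n∣n⇒∣m (∣-trans gcd∣n (subst (+ n ∣_) r*1≡r (∣ᵤ⇒∣ n∣r-kx)))
                             (∣m⇒∣-m (∣n⇒∣m*n k gcd∣x))
  where
  r*1≡r : r * + 1 - k * rep x ≡ r - k * rep x
  r*1≡r = cong (_- k * rep x) (ℤₚ.*-identityʳ r)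
  gcd∣n : + gcd (toℕ x) n ∣ + n
  gcd∣n = ∣ᵤ⇒∣ (gcd[m,n]∣n (toℕ x) n)
  gcd∣x : + gcd (toℕ x) n ∣ rep x
  gcd∣x = ∣ᵤ⇒∣ (gcd[m,n]∣m (toℕ x) n)

IdealProd⇒∣ : ∀ {I J : ℤ → Set} {a b} →
              (∀ {i} → I i → a ∣ i) → (∀ {j} → J j → b ∣ j) →
              ∀ {s} → IdealProd I J s → a * b ∣ s
IdealProd⇒∣ {I} {J} {a} {b} I⊆a J⊆b (ps , ps∈ , refl) = sum∣ ps ps∈
  where
  sum∣ : ∀ ps → All (λ ij → I (proj₁ ij) × J (proj₂ ij)) ps →
         a * b ∣ foldr _+_ (+ 0) (map (λ ij → proj₁ ij * proj₂ ij) ps)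
  sum∣ []            []                = divides (+ 0) refl
  sum∣ ((i , j) ∷ ps) ((i∈ , j∈) ∷ ps∈) =
    ∣m∣n⇒∣m+n (∣-trans (*-monoˡ-∣ b (I⊆a i∈)) (*-monoʳ-∣ i (J⊆b j∈))) (sum∣ ps ps∈)

*∈IdealProd : ∀ {I J : ℤ → Set} {a b} → I a → J b → IdealProd I J (a * b)
*∈IdealProd {a = a} {b} a∈ b∈ =
  (a , b) ∷ [] , (a∈ , b∈) ∷ [] , sym (ℤₚ.+-identityʳ (a * b))

annCond⇔ : ∀ {n} → 1 < n → (x y : Fin n) →
           AnnCond n x y ⇔ n ∣ℕ gcd (toℕ x) n ℕ.* gcd (toℕ y) n
annCond⇔ {n} 1<n@(s≤s (s≤s z≤n)) x y = mk⇔ necessary sufficient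
  where
  gx gy : ℕ
  gx = gcd (toℕ x) n
  gy = gcd (toℕ y) n

  necessary : AnnCond n x y → n ∣ℕ gx ℕ.* gy
  necessary ann = subst (n ∣ℕ_) (cong ℤ.∣_∣ s*1-0≡gxgy)
    (ann (+ gx * + gy) (suc zero)
         (*∈IdealProd {a = + gx} {+ gy} (gcd∣⇒colon x ∣-refl) (gcd∣⇒colon y ∣-refl)))
    where
    s*1-0≡gxgy : + gx * + gy * + 1 - + 0 ≡ + (gx ℕ.* gy)
    s*1-0≡gxgy = begin
      + gx * + gy * + 1 + + 0  ≡⟨ ℤₚ.+-identityʳ _ ⟩
      + gx * + gy * + 1        ≡⟨ ℤₚ.*-identityʳ _ ⟩
      + gx * + gy              ≡⟨ ℤₚ.pos-* gx gy ⟨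
      + (gx ℕ.* gy)            ∎
      where open ≡-Reasoning

  sufficient : n ∣ℕ gx ℕ.* gy → AnnCond n x y
  sufficient n∣gxgy s g s∈ =
    ∣⇒∣ᵤ (subst (+ n ∣_) (sym (ℤₚ.+-identityʳ (s * rep g)))
      (∣m⇒∣m*n (rep g) (∣-trans n∣s (IdealProd⇒∣ (colon⇒gcd∣ 1<n x) (colon⇒gcd∣ 1<n y) s∈))))
    where
    n∣s : + n ∣ + gx * + gy
    n∣s = ∣ᵤ⇒∣ (subst (n ∣ℕ_) (sym (ℤₚ.abs-* (+ gx) (+ gy))) n∣gxgy)

∣p^⇒≡p^ : ∀ {p} → Prime p → ∀ α {d} → d ∣ℕ p ^ α → ∃ λ j → d ≡ p ^ j
∣p^⇒≡p^     pr zero    d∣1    = 0 , ℕᵈ.∣1⇒≡1 d∣1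
∣p^⇒≡p^ {p} pr (suc α) {d} d∣p^ with p ∣? d
... | yes (divides q refl) =
  let j , q≡p^j = ∣p^⇒≡p^ pr α q∣p^α in
  suc j , trans (cong (ℕ._* p) q≡p^j) (ℕₚ.*-comm (p ^ j) p)
  where
  q∣p^α : q ∣ℕ p ^ α
  q∣p^α = ℕᵈ.*-cancelˡ-∣ p {{prime⇒nonZero pr}}
            (subst (_∣ℕ p ^ suc α) (ℕₚ.*-comm q p) d∣p^)
... | no p∤d = ∣p^⇒≡p^ pr α (coprime-divisor d⊥p d∣p^)
  where
  d⊥p : Coprime d p
  d⊥p (i∣d , i∣p) with prime⇒irreducible pr i∣p
  ... | inj₁ i≡1 = i≡1
  ... | inj₂ refl = contradiction i∣d p∤d

p^m∣p^n⇔m≤n : ∀ {p} → 1 < p → ∀ m n → p ^ m ∣ℕ p ^ n ⇔ m ≤ n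
p^m∣p^n⇔m≤n {p@(suc _)} 1<p m n = mk⇔ exponent-≤ power-∣
  where
  exponent-≤ : p ^ m ∣ℕ p ^ n → m ≤ n
  exponent-≤ p^m∣p^n = ℕₚ.≮⇒≥ λ n<m →
    ℕₚ.<⇒≱ (ℕₚ.^-monoʳ-< p 1<p n<m) (ℕᵈ.∣⇒≤ {{ℕₚ.m^n≢0 p n}} p^m∣p^n)
  power-∣ : m ≤ n → p ^ m ∣ℕ p ^ n
  power-∣ m≤n = divides (p ^ (n ℕ.∸ m))
    (trans (cong (p ^_) (sym (ℕₚ.m∸n+n≡m m≤n))) (ℕₚ.^-distribˡ-+-* p (n ℕ.∸ m) m))

primePower-gcd-weights : ∀ {p} → Prime p → ∀ α → ∃ λ (w : Fin (p ^ α) → ℕ) → ∀ x y →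
  p ^ α ∣ℕ gcd (toℕ x) (p ^ α) ℕ.* gcd (toℕ y) (p ^ α) ⇔ α ≤ w x ℕ.+ w y
primePower-gcd-weights {p} pr α = w , λ x y →
  subst (λ k → p ^ α ∣ℕ k ⇔ α ≤ w x ℕ.+ w y) (sym (gcd*gcd≡p^ x y))
        (p^m∣p^n⇔m≤n (ℕ.nonTrivial⇒n>1 p {{prime⇒nonTrivial pr}}) α (w x ℕ.+ w y))
  where
  gcd≡p^ : ∀ x → ∃ λ j → gcd (toℕ x) (p ^ α) ≡ p ^ j
  gcd≡p^ x = ∣p^⇒≡p^ pr α (gcd[m,n]∣n (toℕ x) (p ^ α))
  w : Fin (p ^ α) → ℕ
  w x = proj₁ (gcd≡p^ x)
  gcd*gcd≡p^ : ∀ x y → gcd (toℕ x) (p ^ α) ℕ.* gcd (toℕ y) (p ^ α) ≡ p ^ (w x ℕ.+ w y)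
  gcd*gcd≡p^ x y = trans (cong₂ ℕ._*_ (proj₂ (gcd≡p^ x)) (proj₂ (gcd≡p^ y)))
                         (sym (ℕₚ.^-distribˡ-+-* p (w x) (w y)))

GAAdj-connected : ∀ {n} → 1 < n → Connected (GAAdj n)
GAAdj-connected {n} 1<n@(s≤s (s≤s z≤n)) = dominating⇒connected _≟_ {zero} λ y y≢0 →
  (≢-sym y≢0 , from (annCond⇔ 1<n zero y) (ℕᵈ.m∣m*n (gcd (toℕ y) n))) ,
  (y≢0       , from (annCond⇔ 1<n y zero) (ℕᵈ.n∣m*n (gcd (toℕ y) n)))

GAAdj-threshold : ∀ {n} → 1 < n → (w : Fin n → ℕ) (t : ℕ) →
  (∀ x y → n ∣ℕ gcd (toℕ x) n ℕ.* gcd (toℕ y) n ⇔ t ≤ w x ℕ.+ w y) →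
  IsThreshold (GAAdj n)
GAAdj-threshold 1<n@(s≤s (s≤s z≤n)) w t thr =
  _ , weightAdj-realisable w t λ x y → ⇔-id _ ×-⇔ (thr x y ⇔-∘ annCond⇔ 1<n x y)

theorem5 : (p : ℕ) → Prime p → (α : ℕ) → α > 0 →
    Connected (GAAdj (p ^ α)) × IsThreshold (GAAdj (p ^ α))
theorem5 p pr α α>0 =
  let w , w-threshold = primePower-gcd-weights pr α in
  GAAdj-connected 1<p^α , GAAdj-threshold 1<p^α w α w-threshold
  where
  1<p^α : 1 < p ^ α
  1<p^α = ℕₚ.^-monoʳ-< p (ℕ.nonTrivial⇒n>1 p {{prime⇒nonTrivial pr}}) α>0
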